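{- Let $n\ge1$, $m\ge2$, $1\le r\le m$, and in $T(2n+1,2m,2r)$ let $E_j=\{v_{i,j}v_{i,j+1}: i\in Z_{2n+1}\}$ for $j\in Z_{2m}$, $M_1=E_0\cup E_2\cup\cdots\cup E_{2m-2}$ and $M_2=E_1\cup E_3\cup\cdots\cup E_{2m-1}$. Then $M_1$ and $M_2$ are perfect matchings lying in different components of the resonance graph $R_t(T(2n+1,2m,2r))$.
   Context: Write $Z_k=\{0,\dots,k-1\}$. $T(N,K,R)$ is the graph with vertices $v_{i,j}$ ($i\in Z_N$, $j\in Z_K$, second index mod $K$) and edges $v_{i,j}v_{i,j+1}$, $v_{i,j}v_{i+1,j}$ ($0\le i\le N-2$), $v_{N-1,j}v_{0,j+R}$, embedded on the torus with faces $v_{i,j}v_{i,j+1}v_{i+1,j+1}v_{i+1,j}$ ($0\le i\le N-2$) and $v_{N-1,j}v_{N-1,j+1}v_{0,j+R+1}v_{0,j+R}$. The resonance graph $R_t(G)$ has as vertices the perfect matchings of $G$, two adjacent iff their symmetric difference is the boundary of a face. -}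

module Defs where

open import Data.Nat using (ℕ; zero; suc; _+_; _*_; _≟_; _%_; _≡ᵇ_)
open import Data.Nat.DivMod using (m%n<n)
open import Data.Fin using (Fin; toℕ; fromℕ<)
open import Data.Bool using (Bool; true; false; if_then_else_; _xor_)
open import Data.Product using (_×_; _,_; proj₁; proj₂; ∃; ∃₂)
open import Data.Sum using (_⊎_)
open import Data.List using (List; _∷_; [])
open import Data.List.Membership.Propositional using (_∈_)
open import Relation.Binary.PropositionalEquality using (_≡_)
open import Relation.Nullary.Decidable using (⌊_⌋)
open import Relation.Binary.Construct.Closure.ReflexiveTransitive using (Star)
open import Function.Bundles using (_⇔_)

_⊕_ : ∀ {k} → Fin k → ℕ → Fin k
_⊕_ {suc k} j d = fromℕ< (m%n<n (toℕ j + d) (suc k))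

module T (N K R : ℕ) where

  Vertex : Set
  Vertex = Fin N × Fin K

  -- hor i j : the edge v_{i,j} v_{i,j+1}
  -- ver i j : the edge v_{i,j} v_{i+1,j}  (i ≤ N-2)  resp.  v_{N-1,j} v_{0,j+R}  (i = N-1)
  data Edge : Set where
    hor : Fin N → Fin K → Edge
    ver : Fin N → Fin K → Edge

  shift : Fin N → ℕ
  shift i = if ⌊ suc (toℕ i) ≟ N ⌋ then R else 0

  ends : Edge → Vertex × Vertex
  ends (hor i j) = (i , j) , (i , j ⊕ 1)
  ends (ver i j) = (i , j) , (i ⊕ 1 , j ⊕ shift i)

  Incident : Vertex → Edge → Set
  Incident v e = proj₁ (ends e) ≡ v ⊎ proj₂ (ends e) ≡ v

  -- boundary of the face with corner v_{i,j}:
  --   i ≤ N-2 : v_{i,j} v_{i,j+1} v_{i+1,j+1} v_{i+1,j}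
  --   i = N-1 : v_{N-1,j} v_{N-1,j+1} v_{0,j+R+1} v_{0,j+R}
  faceEdges : Fin N → Fin K → List Edge
  faceEdges i j = hor i j ∷ ver i (j ⊕ 1) ∷ hor (i ⊕ 1) (j ⊕ shift i) ∷ ver i j ∷ []

  EdgeSet : Set
  EdgeSet = Edge → Bool

  IsPerfectMatching : EdgeSet → Set
  IsPerfectMatching M =
    ∀ v → ∃ λ e → M e ≡ true × Incident v e ×
          (∀ e' → M e' ≡ true → Incident v e' → e' ≡ e)

  SymDiffIsFace : EdgeSet → EdgeSet → Set
  SymDiffIsFace M M' = ∃₂ λ i j → ∀ e → ((M e xor M' e) ≡ true) ⇔ (e ∈ faceEdges i j)

  ResAdj : EdgeSet → EdgeSet → Set
  ResAdj M M' = IsPerfectMatching M × IsPerfectMatching M' × SymDiffIsFace M M'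

  SameComponent : EdgeSet → EdgeSet → Set
  SameComponent = Star ResAdj

  M₁ : EdgeSet
  M₁ (hor i j) = toℕ j % 2 ≡ᵇ 0
  M₁ (ver i j) = false

  M₂ : EdgeSet
  M₂ (hor i j) = toℕ j % 2 ≡ᵇ 1
  M₂ (ver i j) = false

{-# OPTIONS --safe #-}
-- M₁ and M₂ use horizontal edges only, so each is a perfect matching because consecutive columns
-- alternate, consistently around the torus since the number of columns is even. To separate them,
-- take the edges crossed by a closed curve in the dual graph (dualLoop). Every face boundary meets
-- this set evenly, so flipping a face preserves the parity of the number of matching edges in it;
-- M₁ has 2n+1 edges there and M₂ none.
module Submission where

open import Defs
open import Algebra.Bundles using (CommutativeRing)
open import Data.Bool using (Bool; true; false; not; _∧_; _xor_; if_then_else_)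
open import Data.Bool.Properties
  using (xor-assoc; xor-identityʳ; not-injective; xor-same; ∧-identityʳ; ∧-zeroʳ; not-involutive
        ; xor-∧-commutativeRing)
open import Algebra.Properties.CommutativeSemigroup
  (CommutativeRing.+-commutativeSemigroup xor-∧-commutativeRing) using (interchange)
open import Level using (Level)
open import Data.Empty using (⊥-elim)
open import Data.Fin using (Fin; zero; suc; toℕ)
open import Data.Fin.Properties
  using (toℕ-injective; toℕ-fromℕ<; toℕ<n; toℕ≤pred[n]) renaming (_≟_ to _≟ᶠ_)
open import Data.List using (List; []; _∷_; _++_; map; tabulate; allFin; length; cartesianProductWith)
open import Data.List.Properties using (length-tabulate)
open import Data.List.Membership.Propositional using (_∈_; _∉_)
open import Data.List.Membership.Propositional.Properties
  using (∈-allFin; ∈-tabulate⁻; ∈-++⁺ˡ; ∈-++⁺ʳ; ∈-cartesianProductWith⁺; ∈-cartesianProductWith⁻)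
open import Data.List.Relation.Unary.All using ([]; _∷_; lookup)
open import Data.List.Relation.Unary.AllPairs using ([]; _∷_)
open import Data.List.Relation.Unary.Any using (here; there)
open import Data.List.Relation.Unary.Unique.Propositional using (Unique)
open import Data.List.Relation.Unary.Unique.Propositional.Properties
  using (++⁺; cartesianProductWith⁺; allFin⁺)
open import Data.Nat using (ℕ; zero; suc; pred; _+_; _*_; _∸_; _%_; _≡ᵇ_; _≤_; _<_; z≤n; s≤s)
open import Data.Nat.Properties
  using (_≟_; _<?_; suc-injective; 0≢1+n; 1+n≢n; m∸n≤m; m+[n∸m]≡n; m∸n+n≡m; m≤n⇒m<n∨m≡n
        ; +-comm; +-assoc; +-identityʳ; *-suc; *-comm; *-monoʳ-≤)
open import Data.Nat.DivMod using (%-distribˡ-+; m%n%n≡m%n; [m+n]%n≡m%n; m<n⇒m%n≡m; n%n≡0; m∣n⇒o%n%m≡o%m)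
open import Data.Nat.Divisibility using (_∣_; divides)
open import Data.Product using (_×_; _,_; ∃)
open import Data.Sum using (_⊎_; inj₁; inj₂)
open import Function using (id; _∘_; case_of_)
open import Function.Bundles using (_⇔_; mk⇔; Equivalence)
open import Relation.Binary.Definitions using (DecidableEquality)
open import Relation.Binary.PropositionalEquality
open import Relation.Binary.Construct.Closure.ReflexiveTransitive using (ε; _◅_)
open import Relation.Nullary using (¬_; yes; no)
open import Relation.Nullary.Decidable using (does; map′; _×-dec_; ⌊_⌋; dec-true; dec-false; does-⇔)

-- Parity sums over lists

private
  variable
    a b c : Level
    A : Set a
    B : Set b
    C : Set c

module _ {A : Set a} where

  parityOf : (A → Bool) → List A → Bool
  parityOf f []       = false
  parityOf f (x ∷ xs) = f x xor parityOf f xs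

  parityOf-cong : ∀ {f g : A → Bool} xs → (∀ {x} → x ∈ xs → f x ≡ g x) →
                  parityOf f xs ≡ parityOf g xs
  parityOf-cong []       _   = refl
  parityOf-cong (x ∷ xs) f≡g = cong₂ _xor_ (f≡g (here refl)) (parityOf-cong xs (f≡g ∘ there))

  parityOf-false : ∀ {f : A → Bool} xs → (∀ {x} → x ∈ xs → f x ≡ false) → parityOf f xs ≡ false
  parityOf-false []       _  = refl
  parityOf-false (x ∷ xs) f≡ = cong₂ _xor_ (f≡ (here refl)) (parityOf-false xs (f≡ ∘ there))

  parityOf-xor : ∀ (f g : A → Bool) xs →
                 parityOf (λ x → f x xor g x) xs ≡ parityOf f xs xor parityOf g xs
  parityOf-xor f g []       = refl
  parityOf-xor f g (x ∷ xs) = trans (cong ((f x xor g x) xor_) (parityOf-xor f g xs))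
                                    (interchange (f x) (g x) (parityOf f xs) (parityOf g xs))

  parityOf-∧ˡ : ∀ b (f : A → Bool) xs → parityOf (λ x → b ∧ f x) xs ≡ b ∧ parityOf f xs
  parityOf-∧ˡ true  f xs = refl
  parityOf-∧ˡ false f xs = parityOf-false xs (λ _ → refl)

  parityOf-++ : ∀ (f : A → Bool) xs ys → parityOf f (xs ++ ys) ≡ parityOf f xs xor parityOf f ys
  parityOf-++ f []       ys = refl
  parityOf-++ f (x ∷ xs) ys = trans (cong (f x xor_) (parityOf-++ f xs ys))
                                   (sym (xor-assoc (f x) (parityOf f xs) (parityOf f ys)))

  parityOf-true-odd : ∀ n {xs : List A} → length xs ≡ suc (2 * n) → parityOf (λ _ → true) xs ≡ true
  parityOf-true-odd zero    {_ ∷ []}         _   = refl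
  parityOf-true-odd (suc n) {_ ∷ _ ∷ xs} len =
    trans (not-involutive _)
          (parityOf-true-odd n {xs} (suc-injective (suc-injective (trans len (cong suc (*-suc 2 n))))))

parityOf-map : ∀ (f : B → Bool) (g : A → B) xs → parityOf f (map g xs) ≡ parityOf (f ∘ g) xs
parityOf-map f g []       = refl
parityOf-map f g (x ∷ xs) = cong (f (g x) xor_) (parityOf-map f g xs)

parityOf-comm : ∀ (h : A → B → Bool) xs ys →
                parityOf (λ x → parityOf (h x) ys) xs ≡ parityOf (λ y → parityOf (λ x → h x y) xs) ys
parityOf-comm h []       ys = sym (parityOf-false ys (λ _ → refl))
parityOf-comm h (x ∷ xs) ys = trans (cong (parityOf (h x) ys xor_) (parityOf-comm h xs ys))
                                    (sym (parityOf-xor (h x) (λ y → parityOf (λ x → h x y) xs) ys))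

parityOf-cartesianProductWith : ∀ (f : C → Bool) (g : A → B → C) xs ys →
  parityOf f (cartesianProductWith g xs ys) ≡ parityOf (λ x → parityOf (λ y → f (g x y)) ys) xs
parityOf-cartesianProductWith f g []       ys = refl
parityOf-cartesianProductWith f g (x ∷ xs) ys = begin
  parityOf f (map (g x) ys ++ cartesianProductWith g xs ys)
    ≡⟨ parityOf-++ f (map (g x) ys) _ ⟩
  parityOf f (map (g x) ys) xor parityOf f (cartesianProductWith g xs ys)
    ≡⟨ cong₂ _xor_ (parityOf-map f (g x) ys) (parityOf-cartesianProductWith f g xs ys) ⟩
  parityOf (λ y → f (g x y)) ys xor parityOf (λ x → parityOf (λ y → f (g x y)) ys) xs ∎
  where open ≡-Reasoning

∧-xor-telescope : ∀ c x y → c ∧ y ≡ (c ∧ x) xor (c ∧ (x xor y))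
∧-xor-telescope false _     _ = refl
∧-xor-telescope true  false _ = refl
∧-xor-telescope true  true  y = sym (not-involutive y)

square-even : ∀ a b c d → b xor d ≡ a xor c → a xor (b xor (c xor (d xor false))) ≡ false
square-even a b c d b+d≡a+c = begin
  a xor (b xor (c xor (d xor false))) ≡⟨ cong (λ t → a xor (b xor (c xor t))) (xor-identityʳ d) ⟩
  a xor (b xor (c xor d))             ≡⟨ sym (xor-assoc a b (c xor d)) ⟩
  (a xor b) xor (c xor d)             ≡⟨ interchange a b c d ⟩
  (a xor c) xor (b xor d)             ≡⟨ cong (_xor (b xor d)) (sym b+d≡a+c) ⟩
  (b xor d) xor (b xor d)             ≡⟨ xor-same (b xor d) ⟩
  false                               ∎
  where open ≡-Reasoning

module _ {A : Set a} (_≟ᴬ_ : DecidableEquality A) where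

  parityOf-≟-∉ : ∀ {x xs} → x ∉ xs → parityOf (λ y → does (y ≟ᴬ x)) xs ≡ false
  parityOf-≟-∉ {x} {xs} x∉xs =
    parityOf-false xs (λ {y} y∈xs → dec-false (y ≟ᴬ x) (λ y≡x → x∉xs (subst (_∈ xs) y≡x y∈xs)))

  parityOf-≟-∈ : ∀ {x xs} → Unique xs → x ∈ xs → parityOf (λ y → does (y ≟ᴬ x)) xs ≡ true
  parityOf-≟-∈ {x} (x∉xs ∷ _) (here refl) =
    cong₂ _xor_ (dec-true (x ≟ᴬ x) refl) (parityOf-≟-∉ (λ x∈xs → lookup x∉xs x∈xs refl))
  parityOf-≟-∈ {x} {y ∷ _} (y∉xs ∷ xs!) (there x∈xs) =
    cong₂ _xor_ (dec-false (y ≟ᴬ x) (lookup y∉xs x∈xs)) (parityOf-≟-∈ xs! x∈xs)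

  parityOf-≟-indicator : ∀ {b x xs} → Unique xs → (b ≡ true ⇔ x ∈ xs) →
                         b ≡ parityOf (λ y → does (y ≟ᴬ x)) xs
  parityOf-≟-indicator {true}  xs! b⇔ = sym (parityOf-≟-∈ xs! (Equivalence.to b⇔ refl))
  parityOf-≟-indicator {false} xs! b⇔ =
    sym (parityOf-≟-∉ (λ x∈xs → case Equivalence.from b⇔ x∈xs of λ ()))

  ∧-≟-swap : ∀ (g : A → Bool) x y → g x ∧ does (y ≟ᴬ x) ≡ g y ∧ does (x ≟ᴬ y)
  ∧-≟-swap g x y with y ≟ᴬ x | x ≟ᴬ y
  ... | yes refl | yes _    = refl
  ... | yes refl | no x≢x   = ⊥-elim (x≢x refl)
  ... | no y≢x   | yes refl = ⊥-elim (y≢x refl)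
  ... | no _     | no _     = trans (∧-zeroʳ (g x)) (sym (∧-zeroʳ (g y)))

  parityOf-pick : ∀ (g : A → Bool) {y xs} → Unique xs → y ∈ xs →
                  parityOf (λ x → g x ∧ does (y ≟ᴬ x)) xs ≡ g y
  parityOf-pick g {y} {xs} xs! y∈xs = begin
    parityOf (λ x → g x ∧ does (y ≟ᴬ x)) xs ≡⟨ parityOf-cong xs (λ {x} _ → ∧-≟-swap g x y) ⟩
    parityOf (λ x → g y ∧ does (x ≟ᴬ y)) xs ≡⟨ parityOf-∧ˡ (g y) _ xs ⟩
    g y ∧ parityOf (λ x → does (x ≟ᴬ y)) xs ≡⟨ cong (g y ∧_) (parityOf-≟-∈ xs! y∈xs) ⟩
    g y ∧ true                              ≡⟨ ∧-identityʳ (g y) ⟩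
    g y                                     ∎
    where open ≡-Reasoning

  -- Double counting: both sides equal the sum of g x · [x = y] over x ∈ xs and y ∈ ys.
  parityOf-∧-indicator : ∀ (g f : A → Bool) {xs ys} → Unique xs → Unique ys →
    (∀ {y} → y ∈ ys → y ∈ xs) → (∀ x → f x ≡ true ⇔ x ∈ ys) →
    parityOf (λ x → g x ∧ f x) xs ≡ parityOf g ys
  parityOf-∧-indicator g f {xs} {ys} xs! ys! ys⊆xs f⇔ = begin
    parityOf (λ x → g x ∧ f x) xs
      ≡⟨ parityOf-cong xs (λ {x} _ → cong (g x ∧_) (parityOf-≟-indicator ys! (f⇔ x))) ⟩
    parityOf (λ x → g x ∧ parityOf (λ y → does (y ≟ᴬ x)) ys) xs
      ≡⟨ parityOf-cong xs (λ {x} _ → sym (parityOf-∧ˡ (g x) _ ys)) ⟩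
    parityOf (λ x → parityOf (λ y → g x ∧ does (y ≟ᴬ x)) ys) xs
      ≡⟨ parityOf-comm (λ x y → g x ∧ does (y ≟ᴬ x)) xs ys ⟩
    parityOf (λ y → parityOf (λ x → g x ∧ does (y ≟ᴬ x)) xs) ys
      ≡⟨ parityOf-cong ys (λ y∈ys → parityOf-pick g xs! (ys⊆xs y∈ys)) ⟩
    parityOf g ys ∎
    where open ≡-Reasoning

-- Modular arithmetic

toℕ-⊕ : ∀ {k} (j : Fin (suc k)) d → toℕ (j ⊕ d) ≡ (toℕ j + d) % suc k
toℕ-⊕ j d = toℕ-fromℕ< _

⊕-identityʳ : ∀ {k} (j : Fin (suc k)) → j ⊕ 0 ≡ j
⊕-identityʳ {k} j = toℕ-injective (begin
  toℕ (j ⊕ 0)        ≡⟨ toℕ-⊕ j 0 ⟩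
  (toℕ j + 0) % suc k ≡⟨ cong (_% suc k) (+-identityʳ (toℕ j)) ⟩
  toℕ j % suc k       ≡⟨ m<n⇒m%n≡m (toℕ<n j) ⟩
  toℕ j               ∎)
  where open ≡-Reasoning

⊕-cancel : ∀ {k} (j : Fin (suc k)) {a b} → a + b ≡ suc k → (j ⊕ a) ⊕ b ≡ j
⊕-cancel {k} j {a} {b} a+b≡K = toℕ-injective (begin
  toℕ ((j ⊕ a) ⊕ b)          ≡⟨ toℕ-⊕ (j ⊕ a) b ⟩
  (toℕ (j ⊕ a) + b) % K      ≡⟨ cong (λ t → (t + b) % K) (toℕ-⊕ j a) ⟩
  ((toℕ j + a) % K + b) % K  ≡⟨ %-absorbˡ (toℕ j + a) b ⟩
  (toℕ j + a + b) % K        ≡⟨ cong (_% K) (trans (+-assoc (toℕ j) a b) (cong (toℕ j +_) a+b≡K)) ⟩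
  (toℕ j + K) % K            ≡⟨ [m+n]%n≡m%n (toℕ j) K ⟩
  toℕ j % K                  ≡⟨ m<n⇒m%n≡m (toℕ<n j) ⟩
  toℕ j                      ∎)
  where
  open ≡-Reasoning
  K = suc k
  %-absorbˡ : ∀ m o → (m % K + o) % K ≡ (m + o) % K
  %-absorbˡ m o = trans (%-distribˡ-+ (m % K) o K)
    (trans (cong (λ t → (t + o % K) % K) (m%n%n≡m%n m K)) (sym (%-distribˡ-+ m o K)))

toℕ-⊕1 : ∀ {k} (j : Fin (suc k)) → toℕ (j ⊕ 1) ≡ suc (toℕ j) ⊎ (toℕ (j ⊕ 1) ≡ 0 × toℕ j ≡ k)
toℕ-⊕1 {k} j with m≤n⇒m<n∨m≡n (toℕ≤pred[n] j)
... | inj₁ j<k = inj₁ (trans (toℕ-⊕ j 1)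
                      (trans (cong (_% suc k) (+-comm (toℕ j) 1)) (m<n⇒m%n≡m (s≤s j<k))))
... | inj₂ j≡k = inj₂ (trans (toℕ-⊕ j 1)
                      (trans (cong (_% suc k) (trans (+-comm (toℕ j) 1) (cong suc j≡k))) (n%n≡0 (suc k)))
                     , j≡k)

⊕1≢id : ∀ {k} (j : Fin (suc (suc k))) → j ⊕ 1 ≢ j
⊕1≢id j j⊕1≡j with toℕ-⊕1 j
... | inj₁ ⊕1≡suc       = 1+n≢n (trans (sym ⊕1≡suc) (cong toℕ j⊕1≡j))
... | inj₂ (⊕1≡0 , j≡k) = 0≢1+n (trans (sym ⊕1≡0) (trans (cong toℕ j⊕1≡j) j≡k))

toℕ-⊕≡0⇔ : ∀ {k} (j : Fin (suc k)) {d} → 1 ≤ d → d ≤ suc k → toℕ (j ⊕ d) ≡ 0 ⇔ toℕ j ≡ suc k ∸ d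
toℕ-⊕≡0⇔ {k} j {suc d} (s≤s z≤n) d≤K = mk⇔ to from
  where
  open ≡-Reasoning
  to : toℕ (j ⊕ suc d) ≡ 0 → toℕ j ≡ k ∸ d
  to ⊕≡0 = begin
    toℕ j                        ≡⟨ cong toℕ (sym (⊕-cancel j (m+[n∸m]≡n d≤K))) ⟩
    toℕ ((j ⊕ suc d) ⊕ (k ∸ d)) ≡⟨ cong (λ i → toℕ (i ⊕ (k ∸ d))) (toℕ-injective {j = zero} ⊕≡0) ⟩
    toℕ (zero ⊕ (k ∸ d))         ≡⟨ toℕ-⊕ zero (k ∸ d) ⟩
    (k ∸ d) % suc k              ≡⟨ m<n⇒m%n≡m (s≤s (m∸n≤m k d)) ⟩
    k ∸ d                        ∎
  from : toℕ j ≡ k ∸ d → toℕ (j ⊕ suc d) ≡ 0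
  from j≡ = begin
    toℕ (j ⊕ suc d)         ≡⟨ toℕ-⊕ j (suc d) ⟩
    (toℕ j + suc d) % suc k ≡⟨ cong (λ t → (t + suc d) % suc k) j≡ ⟩
    (k ∸ d + suc d) % suc k ≡⟨ cong (_% suc k) (m∸n+n≡m d≤K) ⟩
    suc k % suc k           ≡⟨ n%n≡0 (suc k) ⟩
    0                       ∎

≡ᵇ-%2-suc : ∀ {p} → p < 2 → ∀ t → (suc t % 2 ≡ᵇ p) ≡ not (t % 2 ≡ᵇ p)
≡ᵇ-%2-suc {0}           _                0             = refl
≡ᵇ-%2-suc {1}           _                0             = refl
≡ᵇ-%2-suc {0}           _                1             = refl
≡ᵇ-%2-suc {1}           _                1             = refl
≡ᵇ-%2-suc               p<2              (suc (suc t)) = ≡ᵇ-%2-suc p<2 t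
≡ᵇ-%2-suc {suc (suc p)} (s≤s (s≤s ()))  _

<?-suc-xor : ∀ a t → does (a <? suc t) xor does (a <? t) ≡ does (t ≟ a)
<?-suc-xor zero    zero    = refl
<?-suc-xor zero    (suc t) = refl
<?-suc-xor (suc a) zero    = refl
<?-suc-xor (suc a) (suc t) = <?-suc-xor a t

toℕ-⊕1-%2 : ∀ {k} → 2 ∣ suc k → (j : Fin (suc k)) → toℕ (j ⊕ 1) % 2 ≡ suc (toℕ j) % 2
toℕ-⊕1-%2 {k} 2∣K j = begin
  toℕ (j ⊕ 1) % 2            ≡⟨ cong (_% 2) (toℕ-⊕ j 1) ⟩
  (toℕ j + 1) % suc k % 2    ≡⟨ m∣n⇒o%n%m≡o%m 2 (suc k) (toℕ j + 1) 2∣K ⟩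
  (toℕ j + 1) % 2            ≡⟨ cong (_% 2) (+-comm (toℕ j) 1) ⟩
  suc (toℕ j) % 2            ∎
  where open ≡-Reasoning

-- Crossing parities on the torus

module _ (N K R : ℕ) where
  open T N K R

  _≟ₑ_ : DecidableEquality Edge
  hor i j ≟ₑ hor i′ j′ =
    map′ (λ (i≡ , j≡) → cong₂ hor i≡ j≡) (λ { refl → refl , refl }) ((i ≟ᶠ i′) ×-dec (j ≟ᶠ j′))
  ver i j ≟ₑ ver i′ j′ =
    map′ (λ (i≡ , j≡) → cong₂ ver i≡ j≡) (λ { refl → refl , refl }) ((i ≟ᶠ i′) ×-dec (j ≟ᶠ j′))
  hor _ _ ≟ₑ ver _ _   = no (λ ())
  ver _ _ ≟ₑ hor _ _   = no (λ ())

  allEdges : List Edge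
  allEdges = cartesianProductWith hor (allFin N) (allFin K)
          ++ cartesianProductWith ver (allFin N) (allFin K)

  ∈-allEdges : ∀ e → e ∈ allEdges
  ∈-allEdges (hor i j) = ∈-++⁺ˡ (∈-cartesianProductWith⁺ hor (∈-allFin i) (∈-allFin j))
  ∈-allEdges (ver i j) = ∈-++⁺ʳ _ (∈-cartesianProductWith⁺ ver (∈-allFin i) (∈-allFin j))

  allEdges-unique : Unique allEdges
  allEdges-unique =
    ++⁺ (cartesianProductWith⁺ hor (λ { refl → refl , refl }) (allFin⁺ N) (allFin⁺ K))
        (cartesianProductWith⁺ ver (λ { refl → refl , refl }) (allFin⁺ N) (allFin⁺ K))
        (λ (e∈hor , e∈ver) → case ∈-cartesianProductWith⁻ hor (allFin N) (allFin K) e∈hor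
                                 , ∈-cartesianProductWith⁻ ver (allFin N) (allFin K) e∈ver of
          λ { ((_ , _ , _ , _ , refl) , (_ , _ , _ , _ , ())) })

  faceEdges-unique : (∀ (i : Fin N) → i ⊕ 1 ≢ i) → (∀ (j : Fin K) → j ⊕ 1 ≢ j) →
                     ∀ i j → Unique (faceEdges i j)
  faceEdges-unique i⊕1≢i j⊕1≢j i j =
      ((λ ()) ∷ (λ eq → i⊕1≢i i (sym (cong row eq))) ∷ (λ ()) ∷ [])
    ∷ ((λ ()) ∷ (λ eq → j⊕1≢j j (cong column eq)) ∷ [])
    ∷ ((λ ()) ∷ [])
    ∷ []
    ∷ []
    where
    row : Edge → Fin N
    row (hor i _) = i
    row (ver i _) = i
    column : Edge → Fin K
    column (hor _ j) = j
    column (ver _ j) = j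

  crossing : (Edge → Bool) → EdgeSet → Bool
  crossing C M = parityOf (λ e → C e ∧ M e) allEdges

  IsDualCycle : (Edge → Bool) → Set
  IsDualCycle C = ∀ i j → parityOf C (faceEdges i j) ≡ false

  module _ (faces! : ∀ i j → Unique (faceEdges i j)) {C} (C-cycle : IsDualCycle C) where

    crossing-resAdj : ∀ {M M′} → ResAdj M M′ → crossing C M ≡ crossing C M′
    crossing-resAdj {M} {M′} (_ , _ , i , j , M⊕M′⇔face) = sym (begin
      crossing C M′
        ≡⟨ parityOf-cong allEdges (λ {e} _ → ∧-xor-telescope (C e) (M e) (M′ e)) ⟩
      parityOf (λ e → (C e ∧ M e) xor (C e ∧ (M e xor M′ e))) allEdges
        ≡⟨ parityOf-xor _ _ allEdges ⟩
      crossing C M xor parityOf (λ e → C e ∧ (M e xor M′ e)) allEdges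
        ≡⟨ cong (crossing C M xor_) (parityOf-∧-indicator _≟ₑ_ C (λ e → M e xor M′ e)
              allEdges-unique (faces! i j) (λ {e} _ → ∈-allEdges e) M⊕M′⇔face) ⟩
      crossing C M xor parityOf C (faceEdges i j)
        ≡⟨ cong (crossing C M xor_) (C-cycle i j) ⟩
      crossing C M xor false
        ≡⟨ xor-identityʳ (crossing C M) ⟩
      crossing C M ∎)
      where open ≡-Reasoning

    crossing-sameComponent : ∀ {M M′} → SameComponent M M′ → crossing C M ≡ crossing C M′
    crossing-sameComponent ε             = refl
    crossing-sameComponent (adj ◅ path) = trans (crossing-resAdj adj) (crossing-sameComponent path)

-- The dual loop and the two matchings

-- The column count is written suc k so that _⊕_ on columns computes.

module _ (N k R : ℕ) where
  open T N (suc k) R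

  gap : ℕ
  gap = suc k ∸ R

  -- The indicator of 0 < t ≤ gap, written so that its two jumps are visible (between-suc).
  between : ℕ → Bool
  between t = does (0 <? t) xor does (gap <? t)

  -- The curve crosses every row between columns 0 and 1; in the seam between rows N−1 and 0 it
  -- runs past the vertical edges of columns 1, …, gap to compensate the twist R.
  dualLoop : Edge → Bool
  dualLoop (hor i j) = does (toℕ j ≟ 0)
  dualLoop (ver i j) = ⌊ suc (toℕ i) ≟ N ⌋ ∧ between (toℕ j)

  between-suc : ∀ t → between (suc t) xor between t ≡ does (t ≟ 0) xor does (t ≟ gap)
  between-suc t =
    trans (interchange (does (0 <? suc t)) (does (gap <? suc t)) (does (0 <? t)) (does (gap <? t)))
          (cong₂ _xor_ (<?-suc-xor 0 t) (<?-suc-xor gap t))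

  between-⊕1 : 1 ≤ R → ∀ (j : Fin (suc k)) → between (toℕ (j ⊕ 1)) ≡ between (suc (toℕ j))
  between-⊕1 (s≤s {n = r} z≤n) j with toℕ-⊕1 j
  ... | inj₁ ⊕1≡suc       = cong between ⊕1≡suc
  ... | inj₂ (⊕1≡0 , j≡k) = begin
    between (toℕ (j ⊕ 1))         ≡⟨ cong between ⊕1≡0 ⟩
    false                         ≡⟨ cong not (sym (dec-true (gap <? suc k) (s≤s (m∸n≤m k r)))) ⟩
    between (suc k)               ≡⟨ cong (between ∘ suc) (sym j≡k) ⟩
    between (suc (toℕ j))         ∎
    where open ≡-Reasoning

  vertical-xor≡horizontal-xor : 1 ≤ R → R ≤ suc k → ∀ b (j : Fin (suc k)) →
    (b ∧ between (toℕ (j ⊕ 1))) xor (b ∧ between (toℕ j))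
      ≡ does (toℕ j ≟ 0) xor does (toℕ (j ⊕ (if b then R else 0)) ≟ 0)
  vertical-xor≡horizontal-xor _ _ false j =
    sym (trans (cong (λ j′ → does (toℕ j ≟ 0) xor does (toℕ j′ ≟ 0)) (⊕-identityʳ j))
               (xor-same (does (toℕ j ≟ 0))))
  vertical-xor≡horizontal-xor 1≤R R≤K true j = begin
    between (toℕ (j ⊕ 1)) xor between (toℕ j)
      ≡⟨ cong (_xor between (toℕ j)) (between-⊕1 1≤R j) ⟩
    between (suc (toℕ j)) xor between (toℕ j)
      ≡⟨ between-suc (toℕ j) ⟩
    does (toℕ j ≟ 0) xor does (toℕ j ≟ gap)
      ≡⟨ cong (does (toℕ j ≟ 0) xor_) (sym (does-⇔ (toℕ-⊕≡0⇔ j 1≤R R≤K) (toℕ (j ⊕ R) ≟ 0) (toℕ j ≟ gap))) ⟩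
    does (toℕ j ≟ 0) xor does (toℕ (j ⊕ R) ≟ 0) ∎
    where open ≡-Reasoning

  dualLoop-isDualCycle : 1 ≤ R → R ≤ suc k → IsDualCycle N (suc k) R dualLoop
  dualLoop-isDualCycle 1≤R R≤K i j =
    square-even (dualLoop (hor i j)) (dualLoop (ver i (j ⊕ 1)))
                (dualLoop (hor (i ⊕ 1) (j ⊕ shift i))) (dualLoop (ver i j))
                (vertical-xor≡horizontal-xor 1≤R R≤K ⌊ suc (toℕ i) ≟ N ⌋ j)

  dualLoop-crossing-horizontal : ∀ (M : EdgeSet) → (∀ i j → M (ver i j) ≡ false) →
    crossing N (suc k) R dualLoop M ≡ parityOf (λ i → M (hor i zero)) (allFin N)
  dualLoop-crossing-horizontal M M-ver = begin
    parityOf f (horizontal ++ vertical)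
      ≡⟨ parityOf-++ f horizontal vertical ⟩
    parityOf f horizontal xor parityOf f vertical
      ≡⟨ cong₂ _xor_ (parityOf-cartesianProductWith f hor (allFin N) (allFin (suc k)))
                     (parityOf-false vertical vertical-false) ⟩
    parityOf (λ i → M (hor i zero) xor parityOf (λ j → f (hor i j)) (tabulate suc)) (allFin N) xor false
      ≡⟨ xor-identityʳ _ ⟩
    parityOf (λ i → M (hor i zero) xor parityOf (λ j → f (hor i j)) (tabulate suc)) (allFin N)
      ≡⟨ parityOf-cong (allFin N) (λ {i} _ →
           trans (cong (M (hor i zero) xor_) (parityOf-false (tabulate suc) off-column-0))
                 (xor-identityʳ (M (hor i zero)))) ⟩
    parityOf (λ i → M (hor i zero)) (allFin N) ∎
    where
    open ≡-Reasoning
    f : Edge → Bool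
    f e = dualLoop e ∧ M e
    horizontal vertical : List Edge
    horizontal = cartesianProductWith hor (allFin N) (allFin (suc k))
    vertical   = cartesianProductWith ver (allFin N) (allFin (suc k))
    vertical-false : ∀ {e} → e ∈ vertical → f e ≡ false
    vertical-false e∈ with ∈-cartesianProductWith⁻ ver (allFin N) (allFin (suc k)) e∈
    ... | i , j , _ , _ , refl =
      trans (cong (dualLoop (ver i j) ∧_) (M-ver i j)) (∧-zeroʳ (dualLoop (ver i j)))
    off-column-0 : ∀ {i j} → j ∈ tabulate suc → f (hor i j) ≡ false
    off-column-0 j∈ with ∈-tabulate⁻ j∈
    ... | _ , refl = refl

  matched-horizontal : ∀ (M : EdgeSet) → (∀ i j → M (ver i j) ≡ false) →
    ∀ {i j e} → M e ≡ true → Incident (i , j) e → ∃ λ j′ → e ≡ hor i j′ × (j′ ≡ j ⊎ j′ ⊕ 1 ≡ j)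
  matched-horizontal M M-ver {e = ver i j} Me _ = case trans (sym (M-ver i j)) Me of λ ()
  matched-horizontal _ _ {e = hor _ j′} _ (inj₁ refl) = j′ , refl , inj₁ refl
  matched-horizontal _ _ {e = hor _ j′} _ (inj₂ refl) = j′ , refl , inj₂ refl

  horizontal-isPerfectMatching : ∀ (M : EdgeSet) (used : Fin (suc k) → Bool) →
    (∀ j → used (j ⊕ 1) ≡ not (used j)) →
    (∀ i j → M (hor i j) ≡ used j) → (∀ i j → M (ver i j) ≡ false) → IsPerfectMatching M
  horizontal-isPerfectMatching M used alt M-hor M-ver (i , j) with used j in used-j
  ... | true  = hor i j , trans (M-hor i j) used-j , inj₁ refl , unique
    where
    unique : ∀ e → M e ≡ true → Incident (i , j) e → e ≡ hor i j
    unique e Me inc with matched-horizontal M M-ver {i} {j} {e} Me inc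
    ... | _  , refl , inj₁ refl   = refl
    ... | j′ , refl , inj₂ j′⊕1≡j = case trans (sym used-j) (trans (cong used (sym j′⊕1≡j))
                                           (trans (alt j′) (cong not (trans (sym (M-hor i j′)) Me)))) of λ ()
  ... | false =
    hor i (j ⊕ k) , trans (M-hor i (j ⊕ k)) used-pred , inj₂ (cong (i ,_) pred⊕1≡j) , unique
    where
    pred⊕1≡j : (j ⊕ k) ⊕ 1 ≡ j
    pred⊕1≡j = ⊕-cancel j (+-comm k 1)
    used-pred : used (j ⊕ k) ≡ true
    used-pred = not-injective (trans (sym (alt (j ⊕ k))) (trans (cong used pred⊕1≡j) used-j))
    unique : ∀ e → M e ≡ true → Incident (i , j) e → e ≡ hor i (j ⊕ k)
    unique e Me inc with matched-horizontal M M-ver {i} {j} {e} Me inc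
    ... | j′ , refl , inj₁ j′≡j   = case trans (sym used-j) (trans (cong used (sym j′≡j))
                                           (trans (sym (M-hor i j′)) Me)) of λ ()
    ... | j′ , refl , inj₂ j′⊕1≡j = cong (hor i) (trans (sym (⊕-cancel j′ refl)) (cong (_⊕ k) j′⊕1≡j))

  column-parity-alternates : 2 ∣ suc k → ∀ {p} → p < 2 → ∀ (j : Fin (suc k)) →
    (toℕ (j ⊕ 1) % 2 ≡ᵇ p) ≡ not (toℕ j % 2 ≡ᵇ p)
  column-parity-alternates 2∣K {p} p<2 j =
    trans (cong (_≡ᵇ p) (toℕ-⊕1-%2 2∣K j)) (≡ᵇ-%2-suc p<2 (toℕ j))

  M₁-isPerfectMatching : 2 ∣ suc k → IsPerfectMatching M₁
  M₁-isPerfectMatching 2∣K = horizontal-isPerfectMatching M₁ (λ j → toℕ j % 2 ≡ᵇ 0)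
    (column-parity-alternates 2∣K (s≤s z≤n)) (λ _ _ → refl) (λ _ _ → refl)

  M₂-isPerfectMatching : 2 ∣ suc k → IsPerfectMatching M₂
  M₂-isPerfectMatching 2∣K = horizontal-isPerfectMatching M₂ (λ j → toℕ j % 2 ≡ᵇ 1)
    (column-parity-alternates 2∣K (s≤s (s≤s z≤n))) (λ _ _ → refl) (λ _ _ → refl)

  M₁-M₂-disconnected : (∀ i j → Unique (faceEdges i j)) → 1 ≤ R → R ≤ suc k →
    ∀ n → N ≡ suc (2 * n) → ¬ SameComponent M₁ M₂
  M₁-M₂-disconnected faces! 1≤R R≤K n N≡ path = case (begin
    true
      ≡⟨ sym (parityOf-true-odd n {allFin N} (trans (length-tabulate id) N≡)) ⟩
    parityOf (λ _ → true) (allFin N)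
      ≡⟨ sym (dualLoop-crossing-horizontal M₁ (λ _ _ → refl)) ⟩
    crossing N (suc k) R dualLoop M₁
      ≡⟨ crossing-sameComponent N (suc k) R faces! (dualLoop-isDualCycle 1≤R R≤K) path ⟩
    crossing N (suc k) R dualLoop M₂
      ≡⟨ dualLoop-crossing-horizontal M₂ (λ _ _ → refl) ⟩
    parityOf (λ _ → false) (allFin N)
      ≡⟨ parityOf-false (allFin N) (λ _ → refl) ⟩
    false ∎) of λ ()
    where open ≡-Reasoning

lemma3p4 : ∀ (n m r : ℕ) → 1 ≤ n → 2 ≤ m → 1 ≤ r → r ≤ m →
    T.IsPerfectMatching (suc (2 * n)) (2 * m) (2 * r) (T.M₁ (suc (2 * n)) (2 * m) (2 * r))
    × T.IsPerfectMatching (suc (2 * n)) (2 * m) (2 * r) (T.M₂ (suc (2 * n)) (2 * m) (2 * r))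
    × ¬ T.SameComponent (suc (2 * n)) (2 * m) (2 * r)
          (T.M₁ (suc (2 * n)) (2 * m) (2 * r)) (T.M₂ (suc (2 * n)) (2 * m) (2 * r))
lemma3p4 n m r (s≤s z≤n) (s≤s (s≤s z≤n)) (s≤s z≤n) r≤m =
    M₁-isPerfectMatching N k R K-even
  , M₂-isPerfectMatching N k R K-even
  , M₁-M₂-disconnected N k R (faceEdges-unique N (2 * m) R ⊕1≢id ⊕1≢id)
                       (s≤s z≤n) (*-monoʳ-≤ 2 r≤m) n refl
  where
  N k R : ℕ
  N = suc (2 * n)
  -- 2 * m is a successor here, so suc k reduces to 2 * m.
  k = pred (2 * m)
  R = 2 * r
  K-even : 2 ∣ 2 * m
  K-even = divides m (*-comm 2 m)
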